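{- Let $n\ge 1$, and let $\mathcal R_{2n+3}=\{R_i\mid -(n+1)\le i\le n+1\}$ with the relations $R_i$ as defined in the context. Then the algebra $\mathbb S_{2n+3}=\langle \mathcal R_{2n+3},\cap,\cup,\circ,\Rightarrow,R_0,{\sim}\rangle$ is an odd Sugihara chain, and $\mathbf S_{2n+3}\cong\mathbb S_{2n+3}$.
   Context: Fix $n\ge1$. For $p=(p_1,\dots,p_n)\in\mathbb Q^n$ define relations on $\mathbb Q^n$: $(p,q)\in L_1$ iff $p_1<q_1$; for $2\le i\le n$, $(p,q)\in L_i$ iff $(p_1,\dots,p_{i-1})=(q_1,\dots,q_{i-1})$ and $p_i<q_i$. Let $<_n$ be $L_1\cup\dots\cup L_n$ (strict lexicographic order). Let $X=\mathbb Q^n\times\{ -1,1\}$, writing $p^b$ for $(p,b)$, with $p^b\le_X q^d$ iff $p^b=q^d$ or $p<_n q$. Let $\alpha:X\to X$, $\alpha(p^b)=p^{ -b}$. For $R\subseteq X^2$, $R^c=X^2\setminus R$, $R^\smile$ is the converse, and $\circ$ is relational composition. For $1\le j\le n$ let $U_j=\{(p^b,q^d)\mid b,d\in\{ -1,1\},(p,q)\in L_j\}$. Define $R_{ -n-1}=\varnothing$; $R_i=\bigcup_{j=1}^{n+1+i}U_j$ for $-n\le i\le -1$; $R_0={\le_X}$; $R_i=(R_{ -i})^{c\smile}\circ\alpha$ for $1\le i\le n+1$. Operations: ${\sim}R=R^{c\smile}\circ\alpha$, $-R=\alpha\circ R^{c\smile}$, and $R\Rightarrow S={\sim}(-S\circ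 R)$ (equivalently $(R^\smile\circ S^c)^c$). The abstract odd Sugihara chain $\mathbf S_{2k+1}$ ($k\ge1$) has universe $\{a_{ -k},\dots,a_0,\dots,a_k\}$, $a_i\wedge a_j=a_{\min\{i,j\}}$, $a_i\vee a_j=a_{\max\{i,j\}}$, ${\sim}a_j=a_{ -j}$, $a_i\cdot a_j=a_i$ if $|j|<|i|$, $=a_j$ if $|i|<|j|$, $=a_{\min\{i,j\}}$ if $|i|=|j|$; $a_i\to a_j={\sim}a_i\vee a_j$ if $i\le j$ and ${\sim}a_i\wedge a_j$ if $i>j$; identity $1=a_0$. A Sugihara chain is a linearly ordered Sugihara monoid; it is odd if ${\sim}1=1$. -}

module Defs where

open import Level using (Level; _⊔_; suc; 0ℓ)
open import Data.Nat as ℕ using (ℕ; _<ᵇ_)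
open import Data.Integer as ℤ using (ℤ; +_; +[1+_]; -[1+_]; ∣_∣)
open import Data.Rational as ℚ using (ℚ)
open import Data.Fin using (Fin; toℕ)
open import Data.Vec using (Vec; lookup)
open import Data.Bool using (Bool; true; false; not; if_then_else_)
open import Data.Product using (Σ; ∃; _×_; _,_)
open import Data.Sum using (_⊎_)
open import Data.Empty.Polymorphic using (⊥)
open import Relation.Nullary using (¬_; does)
open import Relation.Binary.PropositionalEquality using (_≡_)

record Sig {a} (A : Set a) (ℓ : Level) : Set (a ⊔ suc ℓ) where
  field
    _≈_  : A → A → Set ℓ
    _∧_  : A → A → A
    _∨_  : A → A → A
    _·_  : A → A → A
    _⇒_  : A → A → A
    e    : A
    ~_   : A → A

record IsOddSugiharaChainOn {a ℓ p} {A : Set a} (S : Sig A ℓ) (P : A → Set p)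
       : Set (a ⊔ ℓ ⊔ p) where
  open Sig S
  _≤_ : A → A → Set ℓ
  x ≤ y = (x ∧ y) ≈ x
  field
    ∧-closed : ∀ {x y} → P x → P y → P (x ∧ y)
    ∨-closed : ∀ {x y} → P x → P y → P (x ∨ y)
    ·-closed : ∀ {x y} → P x → P y → P (x · y)
    ⇒-closed : ∀ {x y} → P x → P y → P (x ⇒ y)
    e-closed : P e
    ~-closed : ∀ {x} → P x → P (~ x)
    ≈-refl   : ∀ {x} → P x → x ≈ x
    ≈-sym    : ∀ {x y} → P x → P y → x ≈ y → y ≈ x
    ≈-trans  : ∀ {x y z} → P x → P y → P z → x ≈ y → y ≈ z → x ≈ z
    ∧-cong   : ∀ {x x' y y'} → P x → P x' → P y → P y' → x ≈ x' → y ≈ y' → (x ∧ y) ≈ (x' ∧ y')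
    ∨-cong   : ∀ {x x' y y'} → P x → P x' → P y → P y' → x ≈ x' → y ≈ y' → (x ∨ y) ≈ (x' ∨ y')
    ·-cong   : ∀ {x x' y y'} → P x → P x' → P y → P y' → x ≈ x' → y ≈ y' → (x · y) ≈ (x' · y')
    ⇒-cong   : ∀ {x x' y y'} → P x → P x' → P y → P y' → x ≈ x' → y ≈ y' → (x ⇒ y) ≈ (x' ⇒ y')
    ~-cong   : ∀ {x x'} → P x → P x' → x ≈ x' → (~ x) ≈ (~ x')
    ∧-comm   : ∀ {x y} → P x → P y → (x ∧ y) ≈ (y ∧ x)
    ∨-comm   : ∀ {x y} → P x → P y → (x ∨ y) ≈ (y ∨ x)
    ∧-assoc  : ∀ {x y z} → P x → P y → P z → ((x ∧ y) ∧ z) ≈ (x ∧ (y ∧ z))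
    ∨-assoc  : ∀ {x y z} → P x → P y → P z → ((x ∨ y) ∨ z) ≈ (x ∨ (y ∨ z))
    ∧-absorb : ∀ {x y} → P x → P y → (x ∧ (x ∨ y)) ≈ x
    ∨-absorb : ∀ {x y} → P x → P y → (x ∨ (x ∧ y)) ≈ x
    distrib  : ∀ {x y z} → P x → P y → P z → (x ∧ (y ∨ z)) ≈ ((x ∧ y) ∨ (x ∧ z))
    ·-assoc  : ∀ {x y z} → P x → P y → P z → ((x · y) · z) ≈ (x · (y · z))
    ·-comm   : ∀ {x y} → P x → P y → (x · y) ≈ (y · x)
    ·-identity : ∀ {x} → P x → (e · x) ≈ x
    residuated-⇒ : ∀ {x y z} → P x → P y → P z → (x · y) ≤ z → y ≤ (x ⇒ z)
    residuated-⇐ : ∀ {x y z} → P x → P y → P z → y ≤ (x ⇒ z) → (x · y) ≤ z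
    ~-def    : ∀ {x} → P x → (~ x) ≈ (x ⇒ (~ e))
    ~-invol  : ∀ {x} → P x → (~ (~ x)) ≈ x
    ·-idem   : ∀ {x} → P x → (x · x) ≈ x
    total    : ∀ {x y} → P x → P y → (x ≤ y) ⊎ (y ≤ x)
    odd      : (~ e) ≈ e

record IsoOn {a₁ ℓ₁ p₁ a₂ ℓ₂ p₂} {A₁ : Set a₁} {A₂ : Set a₂}
       (S₁ : Sig A₁ ℓ₁) (P₁ : A₁ → Set p₁) (S₂ : Sig A₂ ℓ₂) (P₂ : A₂ → Set p₂)
       : Set (a₁ ⊔ ℓ₁ ⊔ p₁ ⊔ a₂ ⊔ ℓ₂ ⊔ p₂) where
  module S₁ = Sig S₁
  module S₂ = Sig S₂
  open S₂ using (_≈_)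
  field
    f         : A₁ → A₂
    into      : ∀ {x} → P₁ x → P₂ (f x)
    onto      : ∀ {y} → P₂ y → Σ A₁ λ x → P₁ x × (y ≈ f x)
    injective : ∀ {x y} → P₁ x → P₁ y → f x ≈ f y → S₁._≈_ x y
    resp-≈    : ∀ {x y} → P₁ x → P₁ y → S₁._≈_ x y → f x ≈ f y
    hom-∧     : ∀ {x y} → P₁ x → P₁ y → f (S₁._∧_ x y) ≈ S₂._∧_ (f x) (f y)
    hom-∨     : ∀ {x y} → P₁ x → P₁ y → f (S₁._∨_ x y) ≈ S₂._∨_ (f x) (f y)
    hom-·     : ∀ {x y} → P₁ x → P₁ y → f (S₁._·_ x y) ≈ S₂._·_ (f x) (f y)
    hom-⇒     : ∀ {x y} → P₁ x → P₁ y → f (S₁._⇒_ x y) ≈ S₂._⇒_ (f x) (f y)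
    hom-e     : f S₁.e ≈ S₂.e
    hom-~     : ∀ {x} → P₁ x → f (S₁.~_ x) ≈ S₂.~_ (f x)

-- The abstract odd Sugihara chain 𝐒_{2k+1}: a_i is represented by the
-- integer i, the universe is {i | ∣i∣ ≤ k}, equality is ≡.

𝐒-univ : ℕ → ℤ → Set
𝐒-univ k i = ∣ i ∣ ℕ.≤ k

𝐒-mul : ℤ → ℤ → ℤ
𝐒-mul i j =
  if does (∣ j ∣ ℕ.<? ∣ i ∣) then i
  else if does (∣ i ∣ ℕ.<? ∣ j ∣) then j
  else i ℤ.⊓ j

𝐒-imp : ℤ → ℤ → ℤ
𝐒-imp i j = if does (i ℤ.≤? j) then (ℤ.- i) ℤ.⊔ j else (ℤ.- i) ℤ.⊓ j

𝐒-sig : Sig ℤ 0ℓ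
𝐒-sig = record
  { _≈_ = _≡_ ; _∧_ = ℤ._⊓_ ; _∨_ = ℤ._⊔_ ; _·_ = 𝐒-mul ; _⇒_ = 𝐒-imp
  ; e = + 0 ; ~_ = ℤ.-_ }

module Concrete (n : ℕ) where

  Qn : Set
  Qn = Vec ℚ n

  -- coordinate j : Fin n is the paper's index (toℕ j + 1)
  L : Fin n → Qn → Qn → Set
  L j p q = (∀ (k : Fin n) → toℕ k ℕ.< toℕ j → lookup p k ≡ lookup q k)
            × (lookup p j ℚ.< lookup q j)

  _<ₙ_ : Qn → Qn → Set
  p <ₙ q = Σ (Fin n) λ j → L j p q

  -- X = ℚⁿ × {-1,1}; the Bool true stands for 1, false for -1
  X : Set
  X = Qn × Bool

  Rel : Set₁
  Rel = X → X → Set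

  _≤X_ : Rel
  x ≤X y = (x ≡ y) ⊎ (Data.Product.proj₁ x <ₙ Data.Product.proj₁ y)

  α : X → X
  α (p , b) = (p , not b)

  αR : Rel
  αR x y = y ≡ α x

  _ᶜ : Rel → Rel
  (R ᶜ) x y = ¬ R x y

  _˘ : Rel → Rel
  (R ˘) x y = R y x

  _∘_ : Rel → Rel → Rel
  (R ∘ S) x y = Σ X λ z → R x z × S z y

  _∩_ : Rel → Rel → Rel
  (R ∩ S) x y = R x y × S x y

  _∪_ : Rel → Rel → Rel
  (R ∪ S) x y = R x y ⊎ S x y

  ∅ : Rel
  ∅ x y = ⊥

  ∼_ : Rel → Rel
  ∼ R = ((R ᶜ) ˘) ∘ αR

  −_ : Rel → Rel
  − R = αR ∘ ((R ᶜ) ˘)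

  _⟹_ : Rel → Rel → Rel
  R ⟹ S = ∼ ((− S) ∘ R)

  _≐_ : Rel → Rel → Set
  R ≐ S = ∀ x y → (R x y → S x y) × (S x y → R x y)

  U : Fin n → Rel
  U j (p , b) (q , d) = L j p q

  -- R_{-(k+1)} for 0 ≤ k ≤ n: for k < n (i.e. -n ≤ i ≤ -1) it is
  -- ⋃_{j=1}^{n+1+i} U_j = ⋃_{j=1}^{n-k} U_j, and R_{-n-1} = ∅.
  Rneg : ℕ → Rel
  Rneg k = if k <ᵇ n then (λ x y → Σ (Fin n) λ j → (toℕ j ℕ.< n ℕ.∸ k) × U j x y)
           else ∅

  R : ℤ → Rel
  R (+ 0)      = _≤X_
  R +[1+ k ]   = ((Rneg k ᶜ) ˘) ∘ αR
  R -[1+ k ]   = Rneg k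

  𝓡 : Rel → Set
  𝓡 S = Σ ℤ λ i → (∣ i ∣ ℕ.≤ ℕ.suc n) × (S ≐ R i)

  𝕊-sig : Sig Rel 0ℓ
  𝕊-sig = record
    { _≈_ = _≐_ ; _∧_ = _∩_ ; _∨_ = _∪_ ; _·_ = _∘_ ; _⇒_ = _⟹_
    ; e = R (+ 0) ; ~_ = ∼_ }

-- Every pair x, y ∈ X has a level: the least i with (x, y) ∈ R_i. It is read off from the
-- first coordinate j where x and y differ (it is −(n − j + 1) if x is below y there and
-- n − j + 2 if x is above), or from the signs when x and y have the same coordinates. Hence
-- R_i = {(x, y) | level x y ≤ i}, and the relational operations become integer arithmetic on
-- levels: ∩ and ∪ become min and max, ∼ and − become negation because
-- level (α y) x = 1 − level x y, and composition becomes the Sugihara product. For the last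
-- point, the level satisfies the triangle inequality level x z ≤ level x y · level y z, and
-- conversely intermediate points of the required levels exist because ℚ is dense and
-- unbounded. So i ↦ R_i is an isomorphism from 𝐒_{2n+3} onto 𝕊_{2n+3}, and each law of an
-- odd Sugihara chain holds in 𝕊_{2n+3} either for all relations (lattice laws,
-- associativity, residuation) or by transport along this isomorphism.
module Submission where

open import Defs
open import Level using (lift)
open import Data.Nat as ℕ using (ℕ; zero; suc; z≤n; s≤s; _≤_; _∸_; _+_)
import Data.Nat.Properties as ℕP
open import Data.Integer as ℤ
  using (ℤ; +_; +[1+_]; -[1+_]; ∣_∣; _⊓_; _⊔_; -_; +≤+; -≤-; -≤+; +<+; -<-; -<+; 0ℤ; 1ℤ)
import Data.Integer.Properties as ℤP
open import Data.Rational as ℚ using (ℚ; 0ℚ; 1ℚ)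
import Data.Rational.Properties as ℚP
open import Data.Fin using (Fin; zero; suc; toℕ; fromℕ<; opposite)
import Data.Fin.Properties as FinP
open import Data.Vec using (Vec; []; _∷_; lookup; _[_]≔_; replicate)
open import Data.Vec.Properties using (lookup∘update; lookup∘update′)
open import Data.Bool using (Bool; true; false; not)
open import Data.Bool.Properties using (not-involutive)
open import Data.Product using (Σ; _×_; _,_; proj₁; proj₂; map₁)
import Data.Product
open import Data.Sum using (_⊎_; inj₁; inj₂)
import Data.Sum
open import Relation.Nullary using (¬_; yes; no; contradiction)
open import Relation.Nullary.Reflects using (ofʸ; ofⁿ)
open import Relation.Nullary.Decidable using (dec-true; dec-false; decidable-stable)
open import Relation.Binary using (Tri; tri<; tri≈; tri>; IsEquivalence; Setoid; _⇒_)
open import Relation.Binary.PropositionalEquality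
import Relation.Binary.Reasoning.Setoid as SetoidReasoning
import Algebra.Definitions

-- The Sugihara operations on ℤ

∣j∣<∣i∣⇒𝐒-mul≡i : ∀ i j → ∣ j ∣ ℕ.< ∣ i ∣ → 𝐒-mul i j ≡ i
∣j∣<∣i∣⇒𝐒-mul≡i i j lt rewrite dec-true (∣ j ∣ ℕ.<? ∣ i ∣) lt = refl

∣i∣<∣j∣⇒𝐒-mul≡j : ∀ i j → ∣ i ∣ ℕ.< ∣ j ∣ → 𝐒-mul i j ≡ j
∣i∣<∣j∣⇒𝐒-mul≡j i j lt
  rewrite dec-false (∣ j ∣ ℕ.<? ∣ i ∣) (ℕP.<-asym lt) | dec-true (∣ i ∣ ℕ.<? ∣ j ∣) lt = refl

∣i∣≡∣j∣⇒𝐒-mul≡⊓ : ∀ i j → ∣ i ∣ ≡ ∣ j ∣ → 𝐒-mul i j ≡ i ⊓ j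
∣i∣≡∣j∣⇒𝐒-mul≡⊓ i j eq
  rewrite dec-false (∣ j ∣ ℕ.<? ∣ i ∣) (ℕP.<-irrefl (sym eq))
        | dec-false (∣ i ∣ ℕ.<? ∣ j ∣) (ℕP.<-irrefl eq) = refl

i≤-j⇒𝐒-mul≡⊓ : ∀ {i j} → i ℤ.≤ - j → 𝐒-mul i j ≡ i ⊓ j
i≤-j⇒𝐒-mul≡⊓ {+ a} {+ zero} (+≤+ z≤n) = refl
i≤-j⇒𝐒-mul≡⊓ {+ a} { -[1+ b ]} (+≤+ a≤1+b) with ℕP.m≤n⇒m<n∨m≡n a≤1+b
... | inj₁ a<1+b = trans (∣i∣<∣j∣⇒𝐒-mul≡j (+ a) -[1+ b ] a<1+b)
                         (sym (ℤP.i≥j⇒i⊓j≡j {+ a} { -[1+ b ]} -≤+))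
... | inj₂ a≡1+b = ∣i∣≡∣j∣⇒𝐒-mul≡⊓ (+ a) -[1+ b ] a≡1+b
i≤-j⇒𝐒-mul≡⊓ { -[1+ a ]} {+ zero} _ = trans (∣j∣<∣i∣⇒𝐒-mul≡i -[1+ a ] (+ 0) (s≤s z≤n))
                                            (sym (ℤP.i≤j⇒i⊓j≡i { -[1+ a ]} {+ 0} -≤+))
i≤-j⇒𝐒-mul≡⊓ { -[1+ a ]} {+[1+ b ]} (-≤- b≤a) with ℕP.m≤n⇒m<n∨m≡n b≤a
... | inj₁ b<a = trans (∣j∣<∣i∣⇒𝐒-mul≡i -[1+ a ] +[1+ b ] (s≤s b<a))
                       (sym (ℤP.i≤j⇒i⊓j≡i { -[1+ a ]} {+[1+ b ]} -≤+))
... | inj₂ refl = ∣i∣≡∣j∣⇒𝐒-mul≡⊓ -[1+ a ] +[1+ a ] refl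
i≤-j⇒𝐒-mul≡⊓ { -[1+ a ]} { -[1+ b ]} _ with ℕP.<-cmp a b
... | tri< a<b _ _ = trans (∣i∣<∣j∣⇒𝐒-mul≡j -[1+ a ] -[1+ b ] (s≤s a<b))
                           (sym (ℤP.i≥j⇒i⊓j≡j (-≤- (ℕP.<⇒≤ a<b))))
... | tri≈ _ refl _ = ∣i∣≡∣j∣⇒𝐒-mul≡⊓ -[1+ a ] -[1+ a ] refl
... | tri> _ _ b<a = trans (∣j∣<∣i∣⇒𝐒-mul≡i -[1+ a ] -[1+ b ] (s≤s b<a))
                           (sym (ℤP.i≤j⇒i⊓j≡i (-≤- (ℕP.<⇒≤ b<a))))

-j<i⇒𝐒-mul≡⊔ : ∀ {i j} → - j ℤ.< i → 𝐒-mul i j ≡ i ⊔ j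
-j<i⇒𝐒-mul≡⊔ {+ a} {+ b} _ with ℕP.<-cmp a b
... | tri< a<b _ _ = trans (∣i∣<∣j∣⇒𝐒-mul≡j (+ a) (+ b) a<b)
                           (sym (ℤP.i≤j⇒i⊔j≡j (+≤+ (ℕP.<⇒≤ a<b))))
... | tri≈ _ refl _ = trans (∣i∣≡∣j∣⇒𝐒-mul≡⊓ (+ a) (+ a) refl)
                            (trans (ℤP.⊓-idem (+ a)) (sym (ℤP.⊔-idem (+ a))))
... | tri> _ _ b<a = trans (∣j∣<∣i∣⇒𝐒-mul≡i (+ a) (+ b) b<a)
                           (sym (ℤP.i≥j⇒i⊔j≡i (+≤+ (ℕP.<⇒≤ b<a))))
-j<i⇒𝐒-mul≡⊔ {+ a} { -[1+ b ]} (+<+ 1+b<a) =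
  trans (∣j∣<∣i∣⇒𝐒-mul≡i (+ a) -[1+ b ] 1+b<a) (sym (ℤP.i≥j⇒i⊔j≡i {+ a} { -[1+ b ]} -≤+))
-j<i⇒𝐒-mul≡⊔ { -[1+ a ]} {+[1+ b ]} (-<- a<b) =
  trans (∣i∣<∣j∣⇒𝐒-mul≡j -[1+ a ] +[1+ b ] (s≤s a<b))
        (sym (ℤP.i≤j⇒i⊔j≡j { -[1+ a ]} {+[1+ b ]} -≤+))

i≤-j⇒j≤-i : ∀ {i j} → i ℤ.≤ - j → j ℤ.≤ - i
i≤-j⇒j≤-i {i} {j} h = subst (ℤ._≤ - i) (ℤP.neg-involutive j) (ℤP.neg-mono-≤ h)

-j<i⇒-i<j : ∀ {i j} → - j ℤ.< i → - i ℤ.< j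
-j<i⇒-i<j {i} {j} h = subst (- i ℤ.<_) (ℤP.neg-involutive j) (ℤP.neg-mono-< h)

𝐒-mul-comm : ∀ i j → 𝐒-mul i j ≡ 𝐒-mul j i
𝐒-mul-comm i j with i ℤ.≤? - j
... | yes h = trans (i≤-j⇒𝐒-mul≡⊓ h) (trans (ℤP.⊓-comm i j) (sym (i≤-j⇒𝐒-mul≡⊓ (i≤-j⇒j≤-i h))))
... | no h  = trans (-j<i⇒𝐒-mul≡⊔ h′) (trans (ℤP.⊔-comm i j) (sym (-j<i⇒𝐒-mul≡⊔ (-j<i⇒-i<j h′))))
  where h′ = ℤP.≰⇒> h

𝐒-mul-idem : ∀ i → 𝐒-mul i i ≡ i
𝐒-mul-idem i with i ℤ.≤? - i
... | yes h = trans (i≤-j⇒𝐒-mul≡⊓ h) (ℤP.⊓-idem i)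
... | no h  = trans (-j<i⇒𝐒-mul≡⊔ (ℤP.≰⇒> h)) (ℤP.⊔-idem i)

𝐒-mul-identityˡ : ∀ i → 𝐒-mul 0ℤ i ≡ i
𝐒-mul-identityˡ i with 0ℤ ℤ.≤? - i
... | yes h = trans (i≤-j⇒𝐒-mul≡⊓ h) (ℤP.i≥j⇒i⊓j≡j (i≤-j⇒j≤-i h))
... | no h  = trans (-j<i⇒𝐒-mul≡⊔ h′) (ℤP.i≤j⇒i⊔j≡j (ℤP.<⇒≤ (-j<i⇒-i<j h′)))
  where h′ = ℤP.≰⇒> h

𝐒-mul-sel : ∀ i j → 𝐒-mul i j ≡ i ⊎ 𝐒-mul i j ≡ j
𝐒-mul-sel i j with i ℤ.≤? - j
... | yes h = Data.Sum.map (trans (i≤-j⇒𝐒-mul≡⊓ h)) (trans (i≤-j⇒𝐒-mul≡⊓ h)) (ℤP.⊓-sel i j)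
... | no h  = Data.Sum.map (trans (-j<i⇒𝐒-mul≡⊔ h′)) (trans (-j<i⇒𝐒-mul≡⊔ h′)) (ℤP.⊔-sel i j)
  where h′ = ℤP.≰⇒> h

𝐒-mul-glb : ∀ {i j k} → k ℤ.≤ i → k ℤ.≤ j → k ℤ.≤ 𝐒-mul i j
𝐒-mul-glb {i} {j} k≤i k≤j with 𝐒-mul-sel i j
... | inj₁ eq = subst (_ ℤ.≤_) (sym eq) k≤i
... | inj₂ eq = subst (_ ℤ.≤_) (sym eq) k≤j

-j<i⇒i≤𝐒-mul : ∀ {i j} → - j ℤ.< i → i ℤ.≤ 𝐒-mul i j
-j<i⇒i≤𝐒-mul {i} {j} h = subst (i ℤ.≤_) (sym (-j<i⇒𝐒-mul≡⊔ h)) (ℤP.i≤i⊔j i j)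

-i<j⇒j≤𝐒-mul : ∀ {i j} → - i ℤ.< j → j ℤ.≤ 𝐒-mul i j
-i<j⇒j≤𝐒-mul {i} {j} h = subst (j ℤ.≤_) (𝐒-mul-comm j i) (-j<i⇒i≤𝐒-mul h)

𝐒-mul-monoˡ-≤ : ∀ {i i′} j → i ℤ.≤ i′ → 𝐒-mul i j ℤ.≤ 𝐒-mul i′ j
𝐒-mul-monoˡ-≤ {i} {i′} j i≤i′ with i ℤ.≤? - j | i′ ℤ.≤? - j
... | yes h | yes h′ rewrite i≤-j⇒𝐒-mul≡⊓ h | i≤-j⇒𝐒-mul≡⊓ h′ = ℤP.⊓-monoˡ-≤ j i≤i′
... | yes h | no h′ rewrite i≤-j⇒𝐒-mul≡⊓ h | -j<i⇒𝐒-mul≡⊔ (ℤP.≰⇒> h′) =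
  ℤP.≤-trans (ℤP.i⊓j≤j i j) (ℤP.i≤j⊔i i′ j)
... | no h | yes h′ = contradiction (ℤP.≤-trans i≤i′ h′) h
... | no h | no h′ rewrite -j<i⇒𝐒-mul≡⊔ (ℤP.≰⇒> h) | -j<i⇒𝐒-mul≡⊔ (ℤP.≰⇒> h′) =
  ℤP.⊔-monoˡ-≤ j i≤i′

𝐒-mul-mono-≤ : ∀ {i i′ j j′} → i ℤ.≤ i′ → j ℤ.≤ j′ → 𝐒-mul i j ℤ.≤ 𝐒-mul i′ j′
𝐒-mul-mono-≤ {i} {i′} {j} {j′} i≤i′ j≤j′ = ℤP.≤-trans (𝐒-mul-monoˡ-≤ j i≤i′)
  (subst₂ ℤ._≤_ (𝐒-mul-comm j i′) (𝐒-mul-comm j′ i′) (𝐒-mul-monoˡ-≤ i′ j≤j′))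

𝐒-imp-via-𝐒-mul : ∀ i j → 𝐒-imp i j ≡ - 𝐒-mul (- j) i
𝐒-imp-via-𝐒-mul i j with i ℤ.≤? j
... | yes i≤j = begin
  - i ⊔ j          ≡⟨ ℤP.⊔-comm (- i) j ⟩
  j ⊔ - i          ≡⟨ cong (_⊔ - i) (ℤP.neg-involutive j) ⟨
  - - j ⊔ - i      ≡⟨ ℤP.neg-distrib-⊓-⊔ (- j) i ⟨
  - (- j ⊓ i)      ≡⟨ cong -_ (i≤-j⇒𝐒-mul≡⊓ (ℤP.neg-mono-≤ i≤j)) ⟨
  - 𝐒-mul (- j) i  ∎
  where open ≡-Reasoning
... | no i≰j = begin
  - i ⊓ j          ≡⟨ ℤP.⊓-comm (- i) j ⟩
  j ⊓ - i          ≡⟨ cong (_⊓ - i) (ℤP.neg-involutive j) ⟨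
  - - j ⊓ - i      ≡⟨ ℤP.neg-distrib-⊔-⊓ (- j) i ⟨
  - (- j ⊔ i)      ≡⟨ cong -_ (-j<i⇒𝐒-mul≡⊔ (ℤP.neg-mono-< (ℤP.≰⇒> i≰j))) ⟨
  - 𝐒-mul (- j) i  ∎
  where open ≡-Reasoning

𝐒-imp-sel : ∀ i j → 𝐒-imp i j ≡ - i ⊎ 𝐒-imp i j ≡ j
𝐒-imp-sel i j with 𝐒-mul-sel (- j) i
... | inj₁ eq = inj₂ (trans (𝐒-imp-via-𝐒-mul i j) (trans (cong -_ eq) (ℤP.neg-involutive j)))
... | inj₂ eq = inj₁ (trans (𝐒-imp-via-𝐒-mul i j) (cong -_ eq))

k≤-i⇒i<1-k : ∀ {i k} → k ℤ.≤ - i → i ℤ.< 1ℤ ℤ.- k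
k≤-i⇒i<1-k h = ℤP.suc[i]≤j⇒i<j (ℤP.suc-mono (i≤-j⇒j≤-i h))

i<1-k⇒k≤-i : ∀ {i k} → i ℤ.< 1ℤ ℤ.- k → k ℤ.≤ - i
i<1-k⇒k≤-i {i} {k} h = i≤-j⇒j≤-i (subst (i ℤ.≤_) (ℤP.pred-suc (- k)) (ℤP.i<j⇒i≤pred[j] h))

bounded-sel : ∀ {i j k N} → k ≡ i ⊎ k ≡ j → ∣ i ∣ ℕ.≤ N → ∣ j ∣ ℕ.≤ N → ∣ k ∣ ℕ.≤ N
bounded-sel (inj₁ refl) bi _ = bi
bounded-sel (inj₂ refl) _ bj = bj

bounded-neg : ∀ i {N} → ∣ i ∣ ℕ.≤ N → ∣ - i ∣ ℕ.≤ N
bounded-neg i = subst (ℕ._≤ _) (sym (ℤP.∣-i∣≡∣i∣ i))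

∣i∣≤N⇒i≤N : ∀ {i N} → ∣ i ∣ ℕ.≤ N → i ℤ.≤ + N
∣i∣≤N⇒i≤N {+ _}      h = +≤+ h
∣i∣≤N⇒i≤N { -[1+ _ ]} _ = -≤+

-N≤-[1+t]⇒t<N : ∀ {t N} → - (+ N) ℤ.≤ -[1+ t ] → t ℕ.< N
-N≤-[1+t]⇒t<N {N = suc N} (-≤- t≤N) = s≤s t≤N

t<N⇒-N≤-[1+t] : ∀ {t N} → t ℕ.< N → - (+ N) ℤ.≤ -[1+ t ]
t<N⇒-N≤-[1+t] (s≤s t≤N) = -≤- t≤N

∣i∣≤1+N∧i<j⇒-N≤j : ∀ {i j N} → ∣ i ∣ ℕ.≤ suc N → i ℤ.< j → - (+ N) ℤ.≤ j
∣i∣≤1+N∧i<j⇒-N≤j {j = + _} _ _ = ℤP.neg-≤-pos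
∣i∣≤1+N∧i<j⇒-N≤j { -[1+ a ]} { -[1+ b ]} (s≤s a≤N) (-<- b<a) =
  t<N⇒-N≤-[1+t] (ℕP.<-≤-trans b<a a≤N)

1+t<i∧∣i∣≤1+N⇒t<N : ∀ {t i N} → +[1+ t ] ℤ.< i → ∣ i ∣ ℕ.≤ suc N → t ℕ.< N
1+t<i∧∣i∣≤1+N⇒t<N (+<+ 1+t<a) a≤1+N = ℕ.s≤s⁻¹ (ℕP.<-≤-trans 1+t<a a≤1+N)

<∸⇒< : ∀ {j k m} → j ℕ.< m ∸ k → k ℕ.< m
<∸⇒< {j} h = ℕP.m∸n≢0⇒n<m λ eq → ℕP.n≮0 (subst (j ℕ.<_) eq h)

<∸⇒≤∸suc : ∀ {j k m} → j ℕ.< m ∸ k → k ℕ.≤ m ∸ suc j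
<∸⇒≤∸suc {j} {k} {m} h = ℕP.m+n≤o⇒m≤o∸n k (begin
  k + suc j  ≡⟨ ℕP.+-comm k (suc j) ⟩
  suc j + k  ≤⟨ ℕP.m≤o∸n⇒m+n≤o (suc j) (ℕP.<⇒≤ (<∸⇒< h)) h ⟩
  m          ∎)
  where open ℕP.≤-Reasoning

≤∸suc⇒<∸ : ∀ {j k m} → j ℕ.< m → k ℕ.≤ m ∸ suc j → j ℕ.< m ∸ k
≤∸suc⇒<∸ {j} {k} {m} j<m h = ℕP.m+n≤o⇒m≤o∸n (suc j) (begin
  suc j + k  ≡⟨ ℕP.+-comm (suc j) k ⟩
  k + suc j  ≤⟨ ℕP.m≤o∸n⇒m+n≤o k j<m h ⟩
  m          ∎)
  where open ℕP.≤-Reasoning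

-- The lexicographic order on ℚᵐ

p-1<p : ∀ p → p ℚ.- 1ℚ ℚ.< p
p-1<p p = subst (p ℚ.- 1ℚ ℚ.<_) (ℚP.+-identityʳ p)
  (ℚP.+-mono-≤-< (ℚP.≤-refl {p}) (ℚP.negative⁻¹ (ℚ.- 1ℚ)))

p<p+1 : ∀ p → p ℚ.< p ℚ.+ 1ℚ
p<p+1 p = subst (ℚ._< p ℚ.+ 1ℚ) (ℚP.+-identityʳ p)
  (ℚP.+-mono-≤-< (ℚP.≤-refl {p}) (ℚP.positive⁻¹ 1ℚ))

open Concrete using (L)

module _ {m : ℕ} {a c : ℚ} (p q : Vec ℚ m) where

  L-zero : a ℚ.< c → L (suc m) zero (a ∷ p) (c ∷ q)
  L-zero a<c = (λ _ ()) , a<c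

module _ {m : ℕ} {j : Fin m} {a c : ℚ} (p q : Vec ℚ m) where

  L-suc : a ≡ c → L m j p q → L (suc m) (suc j) (a ∷ p) (c ∷ q)
  L-suc a≡c (agree , lt) = (λ { zero _ → a≡c ; (suc k) (s≤s k<j) → agree k k<j }) , lt

  L-head : L (suc m) (suc j) (a ∷ p) (c ∷ q) → a ≡ c
  L-head (agree , _) = agree zero (s≤s z≤n)

  L-tail : L (suc m) (suc j) (a ∷ p) (c ∷ q) → L m j p q
  L-tail (agree , lt) = (λ k k<j → agree (suc k) (s≤s k<j)) , lt

module _ {m : ℕ} {j : Fin m} (p : Vec ℚ m) {c : ℚ} where

  lookup-[]≔-before : ∀ k → toℕ k ℕ.< toℕ j → lookup (p [ j ]≔ c) k ≡ lookup p k
  lookup-[]≔-before k k<j = lookup∘update′ (FinP.<⇒≢ k<j) p c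

  L-raise : lookup p j ℚ.< c → L m j p (p [ j ]≔ c)
  L-raise lt = (λ k k<j → sym (lookup-[]≔-before k k<j))
             , subst (lookup p j ℚ.<_) (sym (lookup∘update j p c)) lt

  L-lower : c ℚ.< lookup p j → L m j (p [ j ]≔ c) p
  L-lower lt = lookup-[]≔-before , subst (ℚ._< lookup p j) (sym (lookup∘update j p c)) lt

  L-between : ∀ {q} → L m j p q → c ℚ.< lookup q j → L m j (p [ j ]≔ c) q
  L-between (agree , _) lt = (λ k k<j → trans (lookup-[]≔-before k k<j) (agree k k<j))
                           , subst (ℚ._< _) (sym (lookup∘update j p c)) lt

coordFromEnd : ∀ {m t} → t ℕ.< m → Fin m
coordFromEnd t<m = opposite (fromℕ< t<m)

coordFromEnd-depth : ∀ {m t} (t<m : t ℕ.< m) → m ∸ suc (toℕ (coordFromEnd t<m)) ≡ t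
coordFromEnd-depth {m} t<m = begin
  m ∸ suc (toℕ (coordFromEnd t<m))   ≡⟨ FinP.opposite-prop (coordFromEnd t<m) ⟨
  toℕ (opposite (coordFromEnd t<m))  ≡⟨ cong toℕ (FinP.opposite-involutive (fromℕ< t<m)) ⟩
  toℕ (fromℕ< t<m)                   ≡⟨ FinP.toℕ-fromℕ< t<m ⟩
  _                                  ∎
  where open ≡-Reasoning

lowerAt : ∀ {m t} → t ℕ.< m → Vec ℚ m → Vec ℚ m
lowerAt t<m q = q [ coordFromEnd t<m ]≔ (lookup q (coordFromEnd t<m) ℚ.- 1ℚ)

raiseAt : ∀ {m t} → t ℕ.< m → Vec ℚ m → Vec ℚ m
raiseAt t<m p = p [ coordFromEnd t<m ]≔ (lookup p (coordFromEnd t<m) ℚ.+ 1ℚ)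

-- Levels of pairs of points

Point : ℕ → Set
Point m = Vec ℚ m × Bool

bitLevel : Bool → Bool → ℤ
bitLevel true  true  = 0ℤ
bitLevel false false = 0ℤ
bitLevel true  false = 1ℤ
bitLevel false true  = 1ℤ

-- level x y is the least i with (x, y) ∈ R_i (see R≐Rᴸ below).
level : ∀ {m} → Point m → Point m → ℤ
level ([] , b) ([] , d) = bitLevel b d
level {suc m} (a ∷ p , b) (c ∷ q , d) with ℚP.<-cmp a c
... | tri< _ _ _ = -[1+ m ]
... | tri≈ _ _ _ = level (p , b) (q , d)
... | tri> _ _ _ = +[1+ suc m ]

bitLevel-nonneg : ∀ b d → 0ℤ ℤ.≤ bitLevel b d
bitLevel-nonneg true  true  = +≤+ z≤n
bitLevel-nonneg false false = +≤+ z≤n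
bitLevel-nonneg true  false = +≤+ z≤n
bitLevel-nonneg false true  = +≤+ z≤n

bitLevel-≤1 : ∀ b d → bitLevel b d ℤ.≤ 1ℤ
bitLevel-≤1 true  true  = +≤+ z≤n
bitLevel-≤1 false false = +≤+ z≤n
bitLevel-≤1 true  false = ℤP.≤-refl
bitLevel-≤1 false true  = ℤP.≤-refl

bitLevel-refl : ∀ b → bitLevel b b ≡ 0ℤ
bitLevel-refl true  = refl
bitLevel-refl false = refl

bitLevel-zero⇒≡ : ∀ {b d} → bitLevel b d ≡ 0ℤ → b ≡ d
bitLevel-zero⇒≡ {true}  {true}  _ = refl
bitLevel-zero⇒≡ {false} {false} _ = refl

bitLevel-triangle : ∀ b f d → bitLevel b d ℤ.≤ 𝐒-mul (bitLevel b f) (bitLevel f d)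
bitLevel-triangle true  true  true  = ℤP.≤-refl
bitLevel-triangle true  true  false = ℤP.≤-refl
bitLevel-triangle true  false true  = +≤+ z≤n
bitLevel-triangle true  false false = ℤP.≤-refl
bitLevel-triangle false true  true  = ℤP.≤-refl
bitLevel-triangle false true  false = +≤+ z≤n
bitLevel-triangle false false true  = ℤP.≤-refl
bitLevel-triangle false false false = ℤP.≤-refl

module _ {m : ℕ} {a c : ℚ} (p q : Vec ℚ m) (b d : Bool) where

  level-∷-< : a ℚ.< c → level (a ∷ p , b) (c ∷ q , d) ≡ -[1+ m ]
  level-∷-< a<c with ℚP.<-cmp a c
  ... | tri< _ _ _   = refl
  ... | tri≈ a≮c _ _ = contradiction a<c a≮c
  ... | tri> a≮c _ _ = contradiction a<c a≮c

  level-∷-≡ : a ≡ c → level (a ∷ p , b) (c ∷ q , d) ≡ level (p , b) (q , d)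
  level-∷-≡ a≡c with ℚP.<-cmp a c
  ... | tri< _ a≢c _ = contradiction a≡c a≢c
  ... | tri≈ _ _ _   = refl
  ... | tri> _ a≢c _ = contradiction a≡c a≢c

  level-∷-> : c ℚ.< a → level (a ∷ p , b) (c ∷ q , d) ≡ +[1+ suc m ]
  level-∷-> c<a with ℚP.<-cmp a c
  ... | tri< _ _ c≮a = contradiction c<a c≮a
  ... | tri≈ _ _ c≮a = contradiction c<a c≮a
  ... | tri> _ _ _   = refl

level-signs : ∀ {m} (p : Vec ℚ m) b d → level (p , b) (p , d) ≡ bitLevel b d
level-signs []      b d = refl
level-signs (a ∷ p) b d = trans (level-∷-≡ {a = a} p p b d refl) (level-signs p b d)

level-refl : ∀ {m} (x : Point m) → level x x ≡ 0ℤ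
level-refl (p , b) = trans (level-signs p b b) (bitLevel-refl b)

level-zero⇒≡ : ∀ {m} {x y : Point m} → level x y ≡ 0ℤ → x ≡ y
level-zero⇒≡ {x = [] , b} {[] , d} h = cong ([] ,_) (bitLevel-zero⇒≡ h)
level-zero⇒≡ {x = a ∷ p , b} {c ∷ q , d} h with ℚP.<-cmp a c
level-zero⇒≡ {x = a ∷ p , b} {c ∷ q , d} () | tri< _ _ _
... | tri≈ _ refl _ = cong (map₁ (a ∷_)) (level-zero⇒≡ h)
level-zero⇒≡ {x = a ∷ p , b} {c ∷ q , d} () | tri> _ _ _

level-lower : ∀ {m} (x y : Point m) → - (+ m) ℤ.≤ level x y
level-lower ([] , b) ([] , d) = bitLevel-nonneg b d
level-lower {suc m} (a ∷ p , b) (c ∷ q , d) with ℚP.<-cmp a c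
... | tri< _ _ _ = ℤP.≤-refl
... | tri≈ _ _ _ = ℤP.≤-trans (ℤP.neg-mono-≤ (+≤+ (ℕP.n≤1+n m))) (level-lower (p , b) (q , d))
... | tri> _ _ _ = -≤+

level-upper : ∀ {m} (x y : Point m) → level x y ℤ.≤ +[1+ m ]
level-upper ([] , b) ([] , d) = bitLevel-≤1 b d
level-upper {suc m} (a ∷ p , b) (c ∷ q , d) with ℚP.<-cmp a c
... | tri< _ _ _ = -≤+
... | tri≈ _ _ _ = ℤP.≤-trans (level-upper (p , b) (q , d)) (+≤+ (ℕP.n≤1+n (suc m)))
... | tri> _ _ _ = ℤP.≤-refl

neg-level<top : ∀ {m} (x y : Point m) → - level x y ℤ.< +[1+ m ]
neg-level<top {m} x y = ℤP.≤-<-trans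
  (subst (- level x y ℤ.≤_) (ℤP.neg-involutive (+ m)) (ℤP.neg-mono-≤ (level-lower x y)))
  (+<+ (ℕP.n<1+n m))

level-triangle : ∀ {m} (x y z : Point m) → level x z ℤ.≤ 𝐒-mul (level x y) (level y z)
level-triangle ([] , b) ([] , f) ([] , d) = bitLevel-triangle b f d
level-triangle x@(a ∷ p , b) y@(e ∷ r , f) z@(c ∷ q , d) = byHeads (ℚP.<-cmp a e) (ℚP.<-cmp e c)
  where
  ascending : a ℚ.< c → level x z ℤ.≤ 𝐒-mul (level x y) (level y z)
  ascending a<c rewrite level-∷-< p q b d a<c = 𝐒-mul-glb (level-lower x y) (level-lower y z)

  byHeads : Tri (a ℚ.< e) (a ≡ e) (e ℚ.< a) → Tri (e ℚ.< c) (e ≡ c) (c ℚ.< e) →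
            level x z ℤ.≤ 𝐒-mul (level x y) (level y z)
  byHeads (tri< a<e _ _) (tri< e<c _ _) = ascending (ℚP.<-trans a<e e<c)
  byHeads (tri< a<e _ _) (tri≈ _ e≡c _) = ascending (subst (a ℚ.<_) e≡c a<e)
  byHeads (tri≈ _ a≡e _) (tri< e<c _ _) = ascending (subst (ℚ._< c) (sym a≡e) e<c)
  byHeads (tri≈ _ a≡e _) (tri≈ _ e≡c _)
    rewrite level-∷-≡ p q b d (trans a≡e e≡c) | level-∷-≡ p r b f a≡e | level-∷-≡ r q f d e≡c
    = level-triangle (p , b) (r , f) (q , d)
  byHeads (tri> _ _ e<a) _ rewrite level-∷-> p r b f e<a =
    ℤP.≤-trans (level-upper x z) (-j<i⇒i≤𝐒-mul (neg-level<top y z))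
  byHeads _ (tri> _ _ c<e) rewrite level-∷-> r q f d c<e =
    ℤP.≤-trans (level-upper x z) (-i<j⇒j≤𝐒-mul (neg-level<top x y))

level-antisym : ∀ {m} (p q : Vec ℚ m) {b d b′ d′} → bitLevel d′ b′ ≡ 1ℤ ℤ.- bitLevel b d →
                level (q , d′) (p , b′) ≡ 1ℤ ℤ.- level (p , b) (q , d)
level-antisym [] [] h = h
level-antisym (a ∷ p) (c ∷ q) {b′ = b′} {d′} h with ℚP.<-cmp a c
... | tri< a<c _ _  = level-∷-> q p d′ b′ a<c
... | tri≈ _ refl _ = trans (level-∷-≡ {a = a} q p d′ b′ refl) (level-antisym p q h)
... | tri> _ _ c<a  = level-∷-< q p d′ b′ c<a

level-α-swap : ∀ {m} (p q : Vec ℚ m) b d → level (q , not d) (p , b) ≡ 1ℤ ℤ.- level (p , b) (q , d)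
level-α-swap p q b d = level-antisym p q (signs b d)
  where
  signs : ∀ b d → bitLevel (not d) b ≡ 1ℤ ℤ.- bitLevel b d
  signs true  true  = refl
  signs true  false = refl
  signs false true  = refl
  signs false false = refl

level-swap-α : ∀ {m} (p q : Vec ℚ m) b d → level (q , d) (p , not b) ≡ 1ℤ ℤ.- level (p , b) (q , d)
level-swap-α p q b d = level-antisym p q (signs b d)
  where
  signs : ∀ b d → bitLevel d (not b) ≡ 1ℤ ℤ.- bitLevel b d
  signs true  true  = refl
  signs true  false = refl
  signs false true  = refl
  signs false false = refl

level-L : ∀ {m} {j : Fin m} (p q : Vec ℚ m) b d → L m j p q →
          level (p , b) (q , d) ≡ -[1+ m ∸ suc (toℕ j) ]
level-L {j = zero}  (a ∷ p) (c ∷ q) b d (_ , a<c) = level-∷-< p q b d a<c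
level-L {j = suc j} (a ∷ p) (c ∷ q) b d l =
  trans (level-∷-≡ p q b d (L-head p q l)) (level-L p q b d (L-tail p q l))

level-neg⇒L : ∀ {m} (p q : Vec ℚ m) b d → level (p , b) (q , d) ℤ.< 0ℤ →
              Σ (Fin m) λ j → L m j p q
level-neg⇒L [] [] b d h = contradiction (bitLevel-nonneg b d) (ℤP.<⇒≱ h)
level-neg⇒L (a ∷ p) (c ∷ q) b d h with ℚP.<-cmp a c
... | tri< a<c _ _ = zero , L-zero p q a<c
... | tri≈ _ a≡c _ = let j , l = level-neg⇒L p q b d h in suc j , L-suc p q a≡c l
level-neg⇒L (a ∷ p) (c ∷ q) b d (+<+ ()) | tri> _ _ _

level≤-[1+k]⇒L : ∀ {m k} (p q : Vec ℚ m) b d → level (p , b) (q , d) ℤ.≤ -[1+ k ] →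
                 Σ (Fin m) λ j → toℕ j ℕ.< m ∸ k × L m j p q
level≤-[1+k]⇒L p q b d h with level-neg⇒L p q b d (ℤP.≤-<-trans h -<+)
... | j , l = j , ≤∸suc⇒<∸ (FinP.toℕ<n j) (ℤP.drop‿-≤- (subst (ℤ._≤ _) (level-L p q b d l) h)) , l

L⇒level≤-[1+k] : ∀ {m k} {j : Fin m} (p q : Vec ℚ m) b d → toℕ j ℕ.< m ∸ k → L m j p q →
                 level (p , b) (q , d) ℤ.≤ -[1+ k ]
L⇒level≤-[1+k] p q b d j<m∸k l = subst (ℤ._≤ _) (sym (level-L p q b d l)) (-≤- (<∸⇒≤∸suc j<m∸k))

level-dense : ∀ {m} (x z : Point m) → level x z ℤ.< 0ℤ →
              Σ (Point m) λ y → level x y ≡ level x z × level y z ≡ level x z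
level-dense (p , b) (q , d) h with level-neg⇒L p q b d h
... | j , l@(_ , pⱼ<qⱼ) with ℚP.<-dense pⱼ<qⱼ
... | c , pⱼ<c , c<qⱼ =
  (p′ , b) , trans (level-L p p′ b b (L-raise p pⱼ<c)) (sym (level-L p q b d l))
           , trans (level-L p′ q b d (L-between p {q = q} l c<qⱼ)) (sym (level-L p q b d l))
  where p′ = p [ j ]≔ c

level-lowerAt : ∀ {m t} (t<m : t ℕ.< m) q b d → level (lowerAt t<m q , b) (q , d) ≡ -[1+ t ]
level-lowerAt t<m q b d = trans (level-L (lowerAt t<m q) q b d (L-lower q (p-1<p _)))
                                (cong -[1+_] (coordFromEnd-depth t<m))

level-raiseAt : ∀ {m t} (t<m : t ℕ.< m) p b d → level (p , b) (raiseAt t<m p , d) ≡ -[1+ t ]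
level-raiseAt t<m p b d = trans (level-L p (raiseAt t<m p) b d (L-raise p (p<p+1 _)))
                                (cong -[1+_] (coordFromEnd-depth t<m))

level-attains : ∀ {m v} → - (+ m) ℤ.≤ v → v ℤ.≤ +[1+ m ] →
                Σ (Point m) λ x → Σ (Point m) λ y → level x y ≡ v
level-attains {m} { -[1+ t ]} -m≤v _ =
  (lowerAt t<m o , true) , (o , true) , level-lowerAt t<m o true true
  where o = replicate m 0ℚ
        t<m = -N≤-[1+t]⇒t<N -m≤v
level-attains {m} {+ 0} _ _ = (o , true) , (o , true) , level-refl (o , true)
  where o = replicate m 0ℚ
level-attains {m} {+ 1} _ _ = (o , true) , (o , false) , level-signs o true false
  where o = replicate m 0ℚ
level-attains {m} {+ suc (suc t)} _ (+≤+ (s≤s t<m)) =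
  (o , false) , (lowerAt t<m o , true) ,
  trans (level-α-swap (lowerAt t<m o) o true true) (cong (ℤ._-_ 1ℤ) (level-lowerAt t<m o true true))
  where o = replicate m 0ℚ

-- The relations R_i

module Relations (n : ℕ) where

  open Concrete n
  open Algebra.Definitions _≐_

  ≐-isEquivalence : IsEquivalence _≐_
  ≐-isEquivalence = record
    { refl  = λ _ _ → (λ r → r) , (λ r → r)
    ; sym   = λ e x y → proj₂ (e x y) , proj₁ (e x y)
    ; trans = λ e f x y → (λ r → proj₁ (f x y) (proj₁ (e x y) r))
                        , (λ r → proj₂ (e x y) (proj₂ (f x y) r))
    }

  ≐-setoid : Setoid _ _
  ≐-setoid = record { isEquivalence = ≐-isEquivalence }

  open IsEquivalence ≐-isEquivalence using ()
    renaming (refl to ≐-refl; sym to ≐-sym; trans to ≐-trans)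
  open SetoidReasoning ≐-setoid

  α-involutive : ∀ x → α (α x) ≡ x
  α-involutive (p , b) = cong (p ,_) (not-involutive b)

  ∩-cong : Congruent₂ _∩_
  ∩-cong e f x y = Data.Product.map (proj₁ (e x y)) (proj₁ (f x y))
                 , Data.Product.map (proj₂ (e x y)) (proj₂ (f x y))

  ∪-cong : Congruent₂ _∪_
  ∪-cong e f x y = Data.Sum.map (proj₁ (e x y)) (proj₁ (f x y))
                 , Data.Sum.map (proj₂ (e x y)) (proj₂ (f x y))

  ∘-cong : Congruent₂ _∘_
  ∘-cong e f x y = (λ (z , r , s) → z , proj₁ (e x z) r , proj₁ (f z y) s)
                 , (λ (z , r , s) → z , proj₂ (e x z) r , proj₂ (f z y) s)

  ∼-cong : Congruent₁ ∼_
  ∼-cong e x y = (λ (z , ¬r , eq) → z , (λ r → ¬r (proj₂ (e z x) r)) , eq)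
               , (λ (z , ¬r , eq) → z , (λ r → ¬r (proj₁ (e z x) r)) , eq)

  −-cong : Congruent₁ −_
  −-cong e x y = (λ (z , eq , ¬r) → z , eq , (λ r → ¬r (proj₂ (e y z) r)))
               , (λ (z , eq , ¬r) → z , eq , (λ r → ¬r (proj₁ (e y z) r)))

  ⟹-cong : Congruent₂ _⟹_
  ⟹-cong e f = ∼-cong (∘-cong (−-cong f) e)

  ∩-comm : Commutative _∩_
  ∩-comm _ _ _ _ = Data.Product.swap , Data.Product.swap

  ∪-comm : Commutative _∪_
  ∪-comm _ _ _ _ = Data.Sum.swap , Data.Sum.swap

  ∩-assoc : Associative _∩_
  ∩-assoc _ _ _ _ _ = (λ ((r , s) , t) → r , s , t) , (λ (r , s , t) → (r , s) , t)

  ∪-assoc : Associative _∪_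
  ∪-assoc _ _ _ _ _ = Data.Sum.assocʳ , Data.Sum.assocˡ

  ∘-assoc : Associative _∘_
  ∘-assoc _ _ _ _ _ = (λ (w , (z , r , s) , t) → z , r , w , s , t)
                    , (λ (z , r , w , s , t) → w , (z , r , s) , t)

  ∩-absorbs-∪ : _∩_ Absorbs _∪_
  ∩-absorbs-∪ _ _ _ _ = proj₁ , λ r → r , inj₁ r

  ∪-absorbs-∩ : _∪_ Absorbs _∩_
  ∪-absorbs-∩ _ _ _ _ = Data.Sum.[ (λ r → r) , proj₁ ] , inj₁

  ∩-distribˡ-∪ : _∩_ DistributesOverˡ _∪_
  ∩-distribˡ-∪ _ _ _ _ _ = (λ (r , st) → Data.Sum.map (r ,_) (r ,_) st)
                         , Data.Sum.[ Data.Product.map₂ inj₁ , Data.Product.map₂ inj₂ ]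

  ⇒-to-∩≐ : ∀ {A B} → A ⇒ B → (A ∩ B) ≐ A
  ⇒-to-∩≐ A⇒B _ _ = proj₁ , λ r → r , A⇒B r

  ∩≐-to-⇒ : ∀ {A B} → (A ∩ B) ≐ A → A ⇒ B
  ∩≐-to-⇒ e r = proj₂ (proj₂ (e _ _) r)

  ⟹-residual-intro : ∀ {A B C} → (A ∘ B) ⇒ C → B ⇒ (A ⟹ C)
  ⟹-residual-intro {C = C} AB⇒C {x} {y} Bxy =
    α y , (λ (w , (v , v≡ααy , ¬Cwv) , Awx) →
            ¬Cwv (subst (C w) (sym (trans v≡ααy (α-involutive y))) (AB⇒C (x , Awx , Bxy))))
        , sym (α-involutive y)

  ⟹-residual-elim : ∀ {A B C} → (∀ {x y} → ¬ ¬ C x y → C x y) → B ⇒ (A ⟹ C) → (A ∘ B) ⇒ C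
  ⟹-residual-elim stable B⇒A⟹C {x} {y} (w , Axw , Bwy) with B⇒A⟹C Bwy
  ... | z , ¬−CAzw , y≡αz = stable λ ¬Cxy → ¬−CAzw (x , (y , y≡αz , ¬Cxy) , Axw)

  Rᴸ : ℤ → Rel
  Rᴸ i x y = level x y ℤ.≤ i

  Rᴸ-∩ : ∀ i j → (Rᴸ i ∩ Rᴸ j) ≐ Rᴸ (i ⊓ j)
  Rᴸ-∩ i j _ _ = (λ (r , s) → ℤP.⊓-glb r s) , λ r → ℤP.i≤j⊓k⇒i≤j i j r , ℤP.i≤j⊓k⇒i≤k i j r

  Rᴸ-∪ : ∀ i j → (Rᴸ i ∪ Rᴸ j) ≐ Rᴸ (i ⊔ j)
  Rᴸ-∪ i j x y = Data.Sum.[ ℤP.i≤j⇒i≤j⊔k j , ℤP.i≤j⇒i≤k⊔j i ] , from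
    where
    from : Rᴸ (i ⊔ j) x y → (Rᴸ i ∪ Rᴸ j) x y
    from r = Data.Sum.map (λ eq → subst (_ ℤ.≤_) eq r) (λ eq → subst (_ ℤ.≤_) eq r) (ℤP.⊔-sel i j)

  Rᴸ-∼ : ∀ i → (∼ Rᴸ i) ≐ Rᴸ (- i)
  Rᴸ-∼ i x y = to , from
    where
    swap : level (α y) x ≡ 1ℤ ℤ.- level x y
    swap = level-α-swap (proj₁ x) (proj₁ y) (proj₂ x) (proj₂ y)
    to : (∼ Rᴸ i) x y → Rᴸ (- i) x y
    to (z , ¬zx≤i , y≡αz) = i<1-k⇒k≤-i (subst (i ℤ.<_) swap (ℤP.≰⇒> ¬αyx≤i))
      where
      ¬αyx≤i : ¬ Rᴸ i (α y) x
      ¬αyx≤i = subst (λ w → ¬ Rᴸ i w x) (sym (trans (cong α y≡αz) (α-involutive z))) ¬zx≤i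
    from : Rᴸ (- i) x y → (∼ Rᴸ i) x y
    from xy≤-i = α y , ℤP.<⇒≱ (subst (i ℤ.<_) (sym swap) (k≤-i⇒i<1-k xy≤-i)) , sym (α-involutive y)

  Rᴸ-− : ∀ i → (− Rᴸ i) ≐ Rᴸ (- i)
  Rᴸ-− i x y = to , from
    where
    swap : level y (α x) ≡ 1ℤ ℤ.- level x y
    swap = level-swap-α (proj₁ x) (proj₁ y) (proj₂ x) (proj₂ y)
    to : (− Rᴸ i) x y → Rᴸ (- i) x y
    to (_ , refl , ¬yαx≤i) = i<1-k⇒k≤-i (subst (i ℤ.<_) swap (ℤP.≰⇒> ¬yαx≤i))
    from : Rᴸ (- i) x y → (− Rᴸ i) x y
    from xy≤-i = α x , refl , ℤP.<⇒≱ (subst (i ℤ.<_) (sym swap) (k≤-i⇒i<1-k xy≤-i))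

  Bounded : ℤ → Set
  Bounded = 𝐒-univ (suc n)

  ∘-witness-⊓ : ∀ {i j} x z → Rᴸ i x z → Rᴸ j x z → (Rᴸ i ∘ Rᴸ j) x z
  ∘-witness-⊓ {i} {j} x z xz≤i xz≤j with 0ℤ ℤ.≤? i | 0ℤ ℤ.≤? j
  ... | yes 0≤i | _ = x , subst (ℤ._≤ i) (sym (level-refl x)) 0≤i , xz≤j
  ... | no _ | yes 0≤j = z , xz≤i , subst (ℤ._≤ j) (sym (level-refl z)) 0≤j
  ... | no i≱0 | no _ with level-dense x z (ℤP.≤-<-trans xz≤i (ℤP.≰⇒> i≱0))
  ... | y , xy≡xz , yz≡xz = y , subst (ℤ._≤ i) (sym xy≡xz) xz≤i , subst (ℤ._≤ j) (sym yz≡xz) xz≤j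

  -- For j = −(t + 1), a point y just below z at the coordinate followed by t others has
  -- level y z = j and level z y = 1 − j ≤ i, so level x y ≤ i · i = i by the triangle
  -- inequality through z.
  ∘-witness-⊔ˡ : ∀ {i j} x z → Bounded i → - j ℤ.< i → Rᴸ i x z → (Rᴸ i ∘ Rᴸ j) x z
  ∘-witness-⊔ˡ {i} {+ _} x z _ _ xz≤i = z , xz≤i , subst (ℤ._≤ _) (sym (level-refl z)) (+≤+ z≤n)
  ∘-witness-⊔ˡ {i} { -[1+ t ]} x (q , d) bi -j<i xz≤i =
    y , xy≤i , ℤP.≤-reflexive (level-lowerAt t<n q false d)
    where
    t<n = 1+t<i∧∣i∣≤1+N⇒t<N -j<i bi
    y = (lowerAt t<n q , false)
    zy≤i : level (q , d) y ℤ.≤ i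
    zy≤i = subst (ℤ._≤ i)
      (sym (trans (level-swap-α (lowerAt t<n q) q true d)
                  (cong (ℤ._-_ 1ℤ) (level-lowerAt t<n q true d))))
      (ℤP.i<j⇒suc[i]≤j -j<i)
    xy≤i : level x y ℤ.≤ i
    xy≤i = ℤP.≤-trans (level-triangle x (q , d) y)
             (ℤP.≤-trans (𝐒-mul-mono-≤ xz≤i zy≤i) (ℤP.≤-reflexive (𝐒-mul-idem i)))

  ∘-witness-⊔ʳ : ∀ {i j} x z → Bounded j → - i ℤ.< j → Rᴸ j x z → (Rᴸ i ∘ Rᴸ j) x z
  ∘-witness-⊔ʳ {+ _} {j} x z _ _ xz≤j = x , subst (ℤ._≤ _) (sym (level-refl x)) (+≤+ z≤n) , xz≤j
  ∘-witness-⊔ʳ { -[1+ t ]} {j} (p , b) z bj -i<j xz≤j =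
    y , ℤP.≤-reflexive (level-raiseAt t<n p b false) , yz≤j
    where
    t<n = 1+t<i∧∣i∣≤1+N⇒t<N -i<j bj
    y = (raiseAt t<n p , false)
    yx≤j : level y (p , b) ℤ.≤ j
    yx≤j = subst (ℤ._≤ j)
      (sym (trans (level-α-swap p (raiseAt t<n p) b true)
                  (cong (ℤ._-_ 1ℤ) (level-raiseAt t<n p b true))))
      (ℤP.i<j⇒suc[i]≤j -i<j)
    yz≤j : level y z ℤ.≤ j
    yz≤j = ℤP.≤-trans (level-triangle y (p , b) z)
             (ℤP.≤-trans (𝐒-mul-mono-≤ yx≤j xz≤j) (ℤP.≤-reflexive (𝐒-mul-idem j)))

  Rᴸ-∘ : ∀ {i j} → Bounded i → Bounded j → (Rᴸ i ∘ Rᴸ j) ≐ Rᴸ (𝐒-mul i j)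
  Rᴸ-∘ {i} {j} bi bj x z = to , from
    where
    to : (Rᴸ i ∘ Rᴸ j) x z → Rᴸ (𝐒-mul i j) x z
    to (y , xy≤i , yz≤j) = ℤP.≤-trans (level-triangle x y z) (𝐒-mul-mono-≤ xy≤i yz≤j)
    from : Rᴸ (𝐒-mul i j) x z → (Rᴸ i ∘ Rᴸ j) x z
    from xz≤ij with i ℤ.≤? - j
    ... | yes i≤-j = ∘-witness-⊓ x z (proj₁ xz∈) (proj₂ xz∈)
      where xz∈ = proj₂ (Rᴸ-∩ i j x z) (subst (_ ℤ.≤_) (i≤-j⇒𝐒-mul≡⊓ i≤-j) xz≤ij)
    ... | no i≰-j = Data.Sum.[ ∘-witness-⊔ˡ x z bi -j<i , ∘-witness-⊔ʳ x z bj (-j<i⇒-i<j -j<i) ]′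
                      (proj₂ (Rᴸ-∪ i j x z) (subst (_ ℤ.≤_) (-j<i⇒𝐒-mul≡⊔ -j<i) xz≤ij))
      where -j<i = ℤP.≰⇒> i≰-j

  Rᴸ-⟹ : ∀ {i j} → Bounded i → Bounded j → (Rᴸ i ⟹ Rᴸ j) ≐ Rᴸ (𝐒-imp i j)
  Rᴸ-⟹ {i} {j} bi bj = begin
    ∼ ((− Rᴸ j) ∘ Rᴸ i)    ≈⟨ ∼-cong (∘-cong (Rᴸ-− j) ≐-refl) ⟩
    ∼ (Rᴸ (- j) ∘ Rᴸ i)    ≈⟨ ∼-cong (Rᴸ-∘ (bounded-neg j bj) bi) ⟩
    ∼ Rᴸ (𝐒-mul (- j) i)   ≈⟨ Rᴸ-∼ (𝐒-mul (- j) i) ⟩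
    Rᴸ (- 𝐒-mul (- j) i)   ≡⟨ cong Rᴸ (𝐒-imp-via-𝐒-mul i j) ⟨
    Rᴸ (𝐒-imp i j)         ∎

  ≤X≐Rᴸ0 : _≤X_ ≐ Rᴸ 0ℤ
  ≤X≐Rᴸ0 x@(p , b) y@(q , d) = to , from
    where
    to : x ≤X y → Rᴸ 0ℤ x y
    to (inj₁ refl) = ℤP.≤-reflexive (level-refl x)
    to (inj₂ (j , l)) = ℤP.≤-trans (L⇒level≤-[1+k] {k = 0} p q b d (FinP.toℕ<n j) l) -≤+
    from : Rᴸ 0ℤ x y → x ≤X y
    from xy≤0 with ℤP.<-cmp (level x y) 0ℤ
    ... | tri< xy<0 _ _ = inj₂ (level-neg⇒L p q b d xy<0)
    ... | tri≈ _ xy≡0 _ = inj₁ (level-zero⇒≡ xy≡0)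
    ... | tri> _ _ 0<xy = contradiction xy≤0 (ℤP.<⇒≱ 0<xy)

  Rneg≐Rᴸ : ∀ k → Rneg k ≐ Rᴸ -[1+ k ]
  Rneg≐Rᴸ k (p , b) (q , d) with k ℕ.<ᵇ n | ℕP.<ᵇ-reflects-< k n
  ... | true  | ofʸ _ =
    (λ (_ , j<n∸k , l) → L⇒level≤-[1+k] p q b d j<n∸k l) , level≤-[1+k]⇒L p q b d
  ... | false | ofⁿ k≮n = (λ { (lift ()) }) , λ xy≤ →
    contradiction (<∸⇒< (proj₁ (proj₂ (level≤-[1+k]⇒L p q b d xy≤)))) k≮n

  R≐Rᴸ : ∀ i → R i ≐ Rᴸ i
  R≐Rᴸ (+ 0)    = ≤X≐Rᴸ0
  R≐Rᴸ +[1+ k ] = ≐-trans (∼-cong (Rneg≐Rᴸ k)) (Rᴸ-∼ -[1+ k ])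
  R≐Rᴸ -[1+ k ] = Rneg≐Rᴸ k

  Represents₂ : (Rel → Rel → Rel) → (ℤ → ℤ → ℤ) → Set
  Represents₂ _⊕_ f = ∀ i j → Bounded i → Bounded j → Bounded (f i j) × (R i ⊕ R j) ≐ R (f i j)

  viaLevel₂ : ∀ {_⊕_} → Congruent₂ _⊕_ → ∀ i j k → (Rᴸ i ⊕ Rᴸ j) ≐ Rᴸ k → (R i ⊕ R j) ≐ R k
  viaLevel₂ ⊕-cong i j k eq = ≐-trans (⊕-cong (R≐Rᴸ i) (R≐Rᴸ j)) (≐-trans eq (≐-sym (R≐Rᴸ k)))

  represents-∩ : Represents₂ _∩_ _⊓_
  represents-∩ i j bi bj = bounded-sel (ℤP.⊓-sel i j) bi bj , viaLevel₂ ∩-cong i j _ (Rᴸ-∩ i j)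

  represents-∪ : Represents₂ _∪_ _⊔_
  represents-∪ i j bi bj = bounded-sel (ℤP.⊔-sel i j) bi bj , viaLevel₂ ∪-cong i j _ (Rᴸ-∪ i j)

  represents-∘ : Represents₂ _∘_ 𝐒-mul
  represents-∘ i j bi bj = bounded-sel (𝐒-mul-sel i j) bi bj , viaLevel₂ ∘-cong i j _ (Rᴸ-∘ bi bj)

  represents-⟹ : Represents₂ _⟹_ 𝐒-imp
  represents-⟹ i j bi bj =
    bounded-sel (𝐒-imp-sel i j) (bounded-neg i bi) bj , viaLevel₂ ⟹-cong i j _ (Rᴸ-⟹ bi bj)

  represents-∼ : ∀ i → Bounded i → Bounded (- i) × (∼ R i) ≐ R (- i)
  represents-∼ i bi = bounded-neg i bi
                    , ≐-trans (∼-cong (R≐Rᴸ i)) (≐-trans (Rᴸ-∼ i) (≐-sym (R≐Rᴸ (- i))))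

  ∼R0≐R0 : (∼ R 0ℤ) ≐ R 0ℤ
  ∼R0≐R0 = proj₂ (represents-∼ 0ℤ z≤n)

  R-strict : ∀ {i j} → Bounded i → Bounded j → i ℤ.< j → ¬ (R j ≐ R i)
  R-strict {i} {j} bi bj i<j Rj≐Ri with level-attains (∣i∣≤1+N∧i<j⇒-N≤j bi i<j) (∣i∣≤N⇒i≤N bj)
  ... | x , y , xy≡j = ℤP.<⇒≱ i<j (subst (ℤ._≤ i) xy≡j xy≤i)
    where
    xy≤i : level x y ℤ.≤ i
    xy≤i = proj₁ (R≐Rᴸ i x y) (proj₁ (Rj≐Ri x y) (proj₂ (R≐Rᴸ j x y) (ℤP.≤-reflexive xy≡j)))

  R-injective : ∀ {i j} → Bounded i → Bounded j → R i ≐ R j → i ≡ j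
  R-injective {i} {j} bi bj Ri≐Rj with ℤP.<-cmp i j
  ... | tri< i<j _ _ = contradiction (≐-sym Ri≐Rj) (R-strict bi bj i<j)
  ... | tri≈ _ i≡j _ = i≡j
  ... | tri> _ _ j<i = contradiction Ri≐Rj (R-strict bj bi j<i)

  𝓡-closed₂ : ∀ {_⊕_ S T} f → Congruent₂ _⊕_ → Represents₂ _⊕_ f → 𝓡 S → 𝓡 T → 𝓡 (S ⊕ T)
  𝓡-closed₂ f ⊕-cong rep (i , bi , S≐) (j , bj , T≐) =
    f i j , proj₁ (rep i j bi bj) , ≐-trans (⊕-cong S≐ T≐) (proj₂ (rep i j bi bj))

  𝓡-closed-∼ : ∀ {S} → 𝓡 S → 𝓡 (∼ S)
  𝓡-closed-∼ (i , bi , S≐) =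
    - i , proj₁ (represents-∼ i bi) , ≐-trans (∼-cong S≐) (proj₂ (represents-∼ i bi))

  𝓡-stable : ∀ {S} → 𝓡 S → ∀ {x y} → ¬ ¬ S x y → S x y
  𝓡-stable (i , _ , S≐R) {x} {y} ¬¬S =
    proj₂ (S≐Rᴸ x y) (decidable-stable (level x y ℤ.≤? i) λ ¬r → ¬¬S λ s → ¬r (proj₁ (S≐Rᴸ x y) s))
    where S≐Rᴸ = ≐-trans S≐R (R≐Rᴸ i)

  ∘-comm-𝓡 : ∀ {S T} → 𝓡 S → 𝓡 T → (S ∘ T) ≐ (T ∘ S)
  ∘-comm-𝓡 {S} {T} (i , bi , S≐) (j , bj , T≐) = begin
    S ∘ T          ≈⟨ ∘-cong S≐ T≐ ⟩
    R i ∘ R j      ≈⟨ proj₂ (represents-∘ i j bi bj) ⟩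
    R (𝐒-mul i j)  ≡⟨ cong R (𝐒-mul-comm i j) ⟩
    R (𝐒-mul j i)  ≈⟨ proj₂ (represents-∘ j i bj bi) ⟨
    R j ∘ R i      ≈⟨ ∘-cong T≐ S≐ ⟨
    T ∘ S          ∎

  ∘-identityˡ-𝓡 : ∀ {S} → 𝓡 S → (R 0ℤ ∘ S) ≐ S
  ∘-identityˡ-𝓡 {S} (i , bi , S≐) = begin
    R 0ℤ ∘ S        ≈⟨ ∘-cong ≐-refl S≐ ⟩
    R 0ℤ ∘ R i      ≈⟨ proj₂ (represents-∘ 0ℤ i z≤n bi) ⟩
    R (𝐒-mul 0ℤ i)  ≡⟨ cong R (𝐒-mul-identityˡ i) ⟩
    R i             ≈⟨ S≐ ⟨
    S               ∎

  ∘-idem-𝓡 : ∀ {S} → 𝓡 S → (S ∘ S) ≐ S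
  ∘-idem-𝓡 {S} (i , bi , S≐) = begin
    S ∘ S          ≈⟨ ∘-cong S≐ S≐ ⟩
    R i ∘ R i      ≈⟨ proj₂ (represents-∘ i i bi bi) ⟩
    R (𝐒-mul i i)  ≡⟨ cong R (𝐒-mul-idem i) ⟩
    R i            ≈⟨ S≐ ⟨
    S              ∎

  ∼-involutive-𝓡 : ∀ {S} → 𝓡 S → (∼ ∼ S) ≐ S
  ∼-involutive-𝓡 {S} (i , bi , S≐) = begin
    ∼ ∼ S      ≈⟨ ∼-cong (∼-cong S≐) ⟩
    ∼ ∼ R i    ≈⟨ ∼-cong (proj₂ (represents-∼ i bi)) ⟩
    ∼ R (- i)  ≈⟨ proj₂ (represents-∼ (- i) (bounded-neg i bi)) ⟩
    R (- - i)  ≡⟨ cong R (ℤP.neg-involutive i) ⟩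
    R i        ≈⟨ S≐ ⟨
    S          ∎

  ∼-via-⟹-𝓡 : ∀ {S} → 𝓡 S → (∼ S) ≐ (S ⟹ (∼ R 0ℤ))
  ∼-via-⟹-𝓡 {S} (i , bi , S≐) = begin
    ∼ S               ≈⟨ ∼-cong S≐ ⟩
    ∼ R i             ≈⟨ proj₂ (represents-∼ i bi) ⟩
    R (- i)           ≡⟨ cong R (trans (𝐒-imp-via-𝐒-mul i 0ℤ) (cong -_ (𝐒-mul-identityˡ i))) ⟨
    R (𝐒-imp i 0ℤ)    ≈⟨ proj₂ (represents-⟹ i 0ℤ bi z≤n) ⟨
    R i ⟹ R 0ℤ        ≈⟨ ⟹-cong S≐ ∼R0≐R0 ⟨
    S ⟹ (∼ R 0ℤ)      ∎

  ∩-≐ˡ-𝓡 : ∀ {S T i j} → S ≐ R i → T ≐ R j → Bounded i → Bounded j → i ℤ.≤ j → (S ∩ T) ≐ S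
  ∩-≐ˡ-𝓡 {S} {T} {i} {j} S≐ T≐ bi bj i≤j = begin
    S ∩ T      ≈⟨ ∩-cong S≐ T≐ ⟩
    R i ∩ R j  ≈⟨ proj₂ (represents-∩ i j bi bj) ⟩
    R (i ⊓ j)  ≡⟨ cong R (ℤP.i≤j⇒i⊓j≡i i≤j) ⟩
    R i        ≈⟨ S≐ ⟨
    S          ∎

  total-𝓡 : ∀ {S T} → 𝓡 S → 𝓡 T → ((S ∩ T) ≐ S) ⊎ ((T ∩ S) ≐ T)
  total-𝓡 (i , bi , S≐) (j , bj , T≐) =
    Data.Sum.map (∩-≐ˡ-𝓡 S≐ T≐ bi bj) (∩-≐ˡ-𝓡 T≐ S≐ bj bi) (ℤP.≤-total i j)

  chain : IsOddSugiharaChainOn 𝕊-sig 𝓡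
  chain = record
    { ∧-closed     = 𝓡-closed₂ _⊓_ ∩-cong represents-∩
    ; ∨-closed     = 𝓡-closed₂ _⊔_ ∪-cong represents-∪
    ; ·-closed     = 𝓡-closed₂ 𝐒-mul ∘-cong represents-∘
    ; ⇒-closed     = 𝓡-closed₂ 𝐒-imp ⟹-cong represents-⟹
    ; e-closed     = 0ℤ , z≤n , ≐-refl
    ; ~-closed     = 𝓡-closed-∼
    ; ≈-refl       = λ _ → ≐-refl
    ; ≈-sym        = λ _ _ → ≐-sym
    ; ≈-trans      = λ _ _ _ → ≐-trans
    ; ∧-cong       = λ _ _ _ _ → ∩-cong
    ; ∨-cong       = λ _ _ _ _ → ∪-cong
    ; ·-cong       = λ _ _ _ _ → ∘-cong
    ; ⇒-cong       = λ _ _ _ _ → ⟹-cong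
    ; ~-cong       = λ _ _ → ∼-cong
    ; ∧-comm       = λ _ _ → ∩-comm _ _
    ; ∨-comm       = λ _ _ → ∪-comm _ _
    ; ∧-assoc      = λ _ _ _ → ∩-assoc _ _ _
    ; ∨-assoc      = λ _ _ _ → ∪-assoc _ _ _
    ; ∧-absorb     = λ _ _ → ∩-absorbs-∪ _ _
    ; ∨-absorb     = λ _ _ → ∪-absorbs-∩ _ _
    ; distrib      = λ _ _ _ → ∩-distribˡ-∪ _ _ _
    ; ·-assoc      = λ _ _ _ → ∘-assoc _ _ _
    ; ·-comm       = ∘-comm-𝓡
    ; ·-identity   = ∘-identityˡ-𝓡
    ; residuated-⇒ = λ _ _ _ AB≤C → ⇒-to-∩≐ (⟹-residual-intro (∩≐-to-⇒ AB≤C))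
    ; residuated-⇐ = λ _ _ C∈𝓡 B≤A⟹C → ⇒-to-∩≐ (⟹-residual-elim (𝓡-stable C∈𝓡) (∩≐-to-⇒ B≤A⟹C))
    ; ~-def        = ∼-via-⟹-𝓡
    ; ~-invol      = ∼-involutive-𝓡
    ; ·-idem       = ∘-idem-𝓡
    ; total        = total-𝓡
    ; odd          = ∼R0≐R0
    }

  iso : IsoOn 𝐒-sig Bounded 𝕊-sig 𝓡
  iso = record
    { f         = R
    ; into      = λ {i} bi → i , bi , ≐-refl
    ; onto      = λ S∈𝓡 → S∈𝓡
    ; injective = R-injective
    ; resp-≈    = λ { _ _ refl → ≐-refl }
    ; hom-∧     = λ {i} {j} bi bj → ≐-sym (proj₂ (represents-∩ i j bi bj))
    ; hom-∨     = λ {i} {j} bi bj → ≐-sym (proj₂ (represents-∪ i j bi bj))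
    ; hom-·     = λ {i} {j} bi bj → ≐-sym (proj₂ (represents-∘ i j bi bj))
    ; hom-⇒     = λ {i} {j} bi bj → ≐-sym (proj₂ (represents-⟹ i j bi bj))
    ; hom-e     = ≐-refl
    ; hom-~     = λ {i} bi → ≐-sym (proj₂ (represents-∼ i bi))
    }

theorem3p11 : (n : ℕ) → 1 ≤ n →
    IsOddSugiharaChainOn (Concrete.𝕊-sig n) (Concrete.𝓡 n)
    × IsoOn 𝐒-sig (𝐒-univ (suc n)) (Concrete.𝕊-sig n) (Concrete.𝓡 n)
theorem3p11 n _ = Relations.chain n , Relations.iso n
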